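{- For any bounded system $\mathcal{S}$ with interaction formula $\Gamma$ (written in DNF as $\Gamma=\bigvee_{k=1}^N\bigwedge_{\ell=1}^{M_k}p_{k\ell}$), the following boolean formulae over the state variables are equivalent: \[\Theta(\mathcal{N}_\mathcal{S})\equiv\widetilde{\big(\mathrm{pos}(\Theta(\Gamma)\wedge\mathrm{Init}(\mathcal{S}))\big)}.\]
   Context: A component is $\mathcal{C}=\langle\mathsf{P},\mathsf{S},s_0,\Delta\rangle$ (finite ports $\mathsf{P}$, finite states $\mathsf{S}$, initial state $s_0$, transitions $\Delta\subseteq\mathsf{S}\times\mathsf{P}\times\mathsf{S}$ written $s\xrightarrow{p}s'$), with no two different transitions carrying the same port. A bounded system $\mathcal{S}=\langle\mathcal{C}^1,\ldots,\mathcal{C}^n,\Gamma\rangle$ has components $\mathcal{C}^k=\langle\mathsf{P}^k,\mathsf{S}^k,s_0^k,\Delta^k\rangle$ (pairwise disjoint port and state sets) and a positive boolean interaction formula $\Gamma$ over ports. Minimal models of boolean formulae are taken w.r.t. pointwise order on valuations ($\bot<\top$). The marked Petri net $\mathcal{N}_\mathcal{S}$: places $\bigcup_k\mathsf{S}^k$; for each minimal model $\beta$ of $\Gamma$ a transition $\mathfrak{t}_\beta$ with edges $(s,\mathfrak{t}_\beta),(\mathfrak{t}_\beta,s')$ for every $k$ and every $s\xrightarrow{p}s'\in\Delta^k$ with $\beta(p)=\top$; initial marking marks exactly the states $s_0^k$. A trap is a set $W$ of places such that every transition with an input place in $W$ has an output place in $W$; it is marked if it contains an initially marked place. $\Theta(\mathcal{N}_\mathcal{S}):=\bigwedge\{\bigvee_{i=1}^k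 s_i\mid\{s_1,\ldots,s_k\}\text{ is a marked trap of }\mathcal{N}_\mathcal{S}\}$. For a port $p$ with transition $s\xrightarrow{p}s'$, ${}^\bullet p:=s$, $p^\bullet:=s'$ (both $\bot$ if $p$ labels no transition). $\Theta(\Gamma):=\bigwedge_{k=1}^N(\bigvee_{\ell=1}^{M_k}{}^\bullet p_{k\ell})\rightarrow(\bigvee_{\ell=1}^{M_k}p_{k\ell}^\bullet)$, $\mathrm{Init}(\mathcal{S}):=\bigvee_{k=1}^n s_0^k$. For a boolean formula $f$, $\mathrm{pos}(f)$ is the positive formula obtained by deleting all negative literals from the disjunctive normal form of $f$. For a positive formula $f$ the dual $\widetilde{f}$ is defined by $\widetilde{f_1\wedge f_2}=\widetilde{f_1}\vee\widetilde{f_2}$, $\widetilde{f_1\vee f_2}=\widetilde{f_1}\wedge\widetilde{f_2}$, $\widetilde{a}=a$ for variables $a$. $f\equiv g$ means $f$ and $g$ have the same models. -}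

module Defs where

open import Data.Bool using (Bool; true; false; _∧_; _∨_; not; if_then_else_)
open import Data.Nat using (ℕ)
open import Data.Fin using (Fin)
import Data.Fin.Properties as FinP
open import Data.Maybe using (Maybe; just; nothing; maybe′)
open import Data.Product using (Σ; _×_; _,_; proj₁; proj₂)
open import Data.Product.Properties using (≡-dec)
open import Data.List using (List; []; _∷_; map; _++_; filterᵇ; mapMaybe; concatMap; allFin)
open import Relation.Nullary using (does)
open import Data.Bool.ListAction using (all; any)
open import Relation.Binary.Definitions using (DecidableEquality)
open import Relation.Binary.PropositionalEquality using (_≡_)

infixr 6 _∧ᶠ_
infixr 5 _∨ᶠ_
infixr 4 _⇒ᶠ_

data Form (V : Set) : Set where
  var   : V → Form V
  ⊤ᶠ ⊥ᶠ : Form V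
  ¬ᶠ_   : Form V → Form V
  _∧ᶠ_ _∨ᶠ_ _⇒ᶠ_ : Form V → Form V → Form V

data PForm (V : Set) : Set where
  pvar  : V → PForm V
  ⊤ᵖ ⊥ᵖ : PForm V
  _∧ᵖ_ _∨ᵖ_ : PForm V → PForm V → PForm V

module _ {V : Set} where

  eval : (V → Bool) → Form V → Bool
  eval v (var x)   = v x
  eval v ⊤ᶠ        = true
  eval v ⊥ᶠ        = false
  eval v (¬ᶠ f)    = not (eval v f)
  eval v (f ∧ᶠ g)  = eval v f ∧ eval v g
  eval v (f ∨ᶠ g)  = eval v f ∨ eval v g
  eval v (f ⇒ᶠ g)  = not (eval v f) ∨ eval v g

  evalᵖ : (V → Bool) → PForm V → Bool
  evalᵖ v (pvar x)  = v x
  evalᵖ v ⊤ᵖ        = true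
  evalᵖ v ⊥ᵖ        = false
  evalᵖ v (f ∧ᵖ g)  = evalᵖ v f ∧ evalᵖ v g
  evalᵖ v (f ∨ᵖ g)  = evalᵖ v f ∨ evalᵖ v g

  embed : PForm V → Form V
  embed (pvar x) = var x
  embed ⊤ᵖ       = ⊤ᶠ
  embed ⊥ᵖ       = ⊥ᶠ
  embed (f ∧ᵖ g) = embed f ∧ᶠ embed g
  embed (f ∨ᵖ g) = embed f ∨ᶠ embed g

  dual : PForm V → PForm V
  dual (pvar x) = pvar x
  dual ⊤ᵖ       = ⊥ᵖ
  dual ⊥ᵖ       = ⊤ᵖ
  dual (f ∧ᵖ g) = dual f ∨ᵖ dual g
  dual (f ∨ᵖ g) = dual f ∧ᵖ dual g

  ⋀ᶠ ⋁ᶠ : List (Form V) → Form V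
  ⋀ᶠ []       = ⊤ᶠ
  ⋀ᶠ (f ∷ fs) = f ∧ᶠ ⋀ᶠ fs
  ⋁ᶠ []       = ⊥ᶠ
  ⋁ᶠ (f ∷ fs) = f ∨ᶠ ⋁ᶠ fs

  ⋀ᵖ ⋁ᵖ : List (PForm V) → PForm V
  ⋀ᵖ []       = ⊤ᵖ
  ⋀ᵖ (f ∷ fs) = f ∧ᵖ ⋀ᵖ fs
  ⋁ᵖ []       = ⊥ᵖ
  ⋁ᵖ (f ∷ fs) = f ∨ᵖ ⋁ᵖ fs

  _≡ᶠ_ : Form V → Form V → Set
  f ≡ᶠ g = ∀ (v : V → Bool) → eval v f ≡ eval v g

  data Lit : Set where
    posL negL : V → Lit

  positives : List Lit → List V
  positives []            = []
  positives (posL x ∷ ls) = x ∷ positives ls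
  positives (negL x ∷ ls) = positives ls

-- all sublists (= subsets, for a duplicate-free list)
subsets : {A : Set} → List A → List (List A)
subsets []       = [] ∷ []
subsets (x ∷ xs) = map (x ∷_) (subsets xs) ++ subsets xs

-- Finite sets of variables: valuations as subsets of an enumeration

module Finite {V : Set} (_≟_ : DecidableEquality V) (vars : List V) where

  _∈ᵇ_ : V → List V → Bool
  x ∈ᵇ S = any (λ y → does (x ≟ y)) S

  ⟦_⟧ : List V → V → Bool
  ⟦ S ⟧ x = x ∈ᵇ S

  _⊆ᵇ_ : List V → List V → Bool
  S ⊆ᵇ T = all (λ x → x ∈ᵇ T) S

  -- the (canonical, full) disjunctive normal form of f over the variables
  -- `vars`: one minterm per model of f
  minterm : List V → List Lit
  minterm S = map (λ x → if x ∈ᵇ S then posL x else negL x) vars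

  DNF : Form V → List (List Lit)
  DNF f = map minterm (filterᵇ (λ S → eval ⟦ S ⟧ f) (subsets vars))

  pos : Form V → PForm V
  pos f = ⋁ᵖ (map (λ t → ⋀ᵖ (map pvar (positives t))) (DNF f))

  -- minimal models (pointwise order on valuations) of a positive formula,
  -- given as the sets of variables they make true
  isMinModel : PForm V → List V → Bool
  isMinModel Γ S =
    evalᵖ ⟦ S ⟧ Γ ∧
    all (λ S′ → not (S′ ⊆ᵇ S ∧ evalᵖ ⟦ S′ ⟧ Γ) ∨ (S ⊆ᵇ S′)) (subsets vars)

  minModels : PForm V → List (List V)
  minModels Γ = filterᵇ (isMinModel Γ) (subsets vars)

-- Since no two different
-- transitions carry the same port, the transition relation Δ is given as
-- a partial map  port p ↦ (s , s')  meaning  s --p--> s'.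
record Component : Set where
  field
    nP nS : ℕ
    s₀    : Fin nS
    Δ     : Fin nP → Maybe (Fin nS × Fin nS)

-- Components are indexed by Fin n; global ports/states are tagged with the
-- component index, hence pairwise disjoint.
record BoundedSystem : Set where
  field
    n : ℕ
    C : Fin n → Component
    Γ : PForm (Σ (Fin n) (λ k → Fin (Component.nP (C k))))

module _ (𝒮 : BoundedSystem) where
  open BoundedSystem 𝒮
  open Component

  State : Set
  State = Σ (Fin n) (λ k → Fin (nS (C k)))

  Port : Set
  Port = Σ (Fin n) (λ k → Fin (nP (C k)))

  _≟S_ : DecidableEquality State
  _≟S_ = ≡-dec FinP._≟_ FinP._≟_

  _≟P_ : DecidableEquality Port
  _≟P_ = ≡-dec FinP._≟_ FinP._≟_

  allStates : List State
  allStates = concatMap (λ k → map (k ,_) (allFin (nS (C k)))) (allFin n)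

  allPorts : List Port
  allPorts = concatMap (λ k → map (k ,_) (allFin (nP (C k)))) (allFin n)

  -- •p and p• (nothing = ⊥ when p labels no transition)
  pre post : Port → Maybe State
  pre  (k , p) = maybe′ (λ t → just (k , proj₁ t)) nothing (Δ (C k) p)
  post (k , p) = maybe′ (λ t → just (k , proj₂ t)) nothing (Δ (C k) p)

  minimalModels : List (List Port)
  minimalModels = Finite.minModels _≟P_ allPorts Γ

  -- The Petri net N_S: places = states; one transition t_β per minimal
  -- model β of Γ, given by (input places , output places)
  netTransitions : List (List State × List State)
  netTransitions = map (λ β → (mapMaybe pre β , mapMaybe post β)) minimalModels

  initialMarking : List State
  initialMarking = map (λ k → (k , s₀ (C k))) (allFin n)

  open Finite _≟S_ allStates using (_∈ᵇ_; pos)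

  isTrap : List State → Bool
  isTrap W = all (λ t → not (any (_∈ᵇ W) (proj₁ t)) ∨ any (_∈ᵇ W) (proj₂ t))
                 netTransitions

  isMarked : List State → Bool
  isMarked W = any (_∈ᵇ W) initialMarking

  ΘN : Form State
  ΘN = ⋀ᶠ (map (λ W → ⋁ᶠ (map var W))
               (filterᵇ (λ W → isTrap W ∧ isMarked W) (subsets allStates)))

  preF postF : Port → Form State
  preF  p = maybe′ var ⊥ᶠ (pre p)
  postF p = maybe′ var ⊥ᶠ (post p)

  -- Θ(Γ), w.r.t. the DNF of Γ whose terms are its minimal models
  ΘΓ : Form State
  ΘΓ = ⋀ᶠ (map (λ β → ⋁ᶠ (map preF β) ⇒ᶠ ⋁ᶠ (map postF β)) minimalModels)

  Init : Form State
  Init = ⋁ᶠ (map (λ k → var (k , s₀ (C k))) (allFin n))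

  posΘΓInit : PForm State
  posΘΓInit = pos (ΘΓ ∧ᶠ Init)

-- Both sides are conjunctions, indexed by certain sets of states, of the
-- disjunction of the states in the set; the theorem says the index sets agree.
--
--  * Left side: by definition Θ(N_S) = ⋀ { ⋁ W | W a marked trap }.
--  * Right side: for any formula f, the DNF of f has one minterm per model S,
--    pos deletes the negative literals (leaving ⋀ S), and dualising yields
--    ⋀ { ⋁ S | S a model of f }  (lemma evalᵖ-dual-pos).
--  * A set of states W, read as the valuation true exactly on W, satisfies
--    Θ(Γ) iff W is a trap (each conjunct of Θ(Γ) is the trap condition for one
--    net transition t_β), and satisfies Init iff W is marked
--    (lemma models-are-marked-traps).
module Submission where

open import Defs
open import Data.Bool using (Bool; true; false; _∧_; _∨_; not; T; if_then_else_)
open import Data.Maybe using (Maybe; just; nothing; maybe′)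
open import Data.Product using (_×_; _,_; proj₁; proj₂)
open import Data.List using (List; []; _∷_; map; filterᵇ; mapMaybe; allFin)
open import Data.List.Properties using (map-∘; map-cong; filter-≐)
import Data.List.Relation.Unary.Any as Any
open import Data.List.Relation.Unary.Any.Properties using (any⁺; any⁻)
open import Data.List.Membership.Propositional using (_∈_; find; lose)
open import Data.List.Membership.Propositional.Properties
  using (∈-allFin; ∈-map⁺; ∈-concatMap⁺; ∈-filter⁺; ∈-filter⁻)
open import Data.Bool.ListAction using (all; any; and; or)
open import Data.Empty using (⊥-elim)
open import Function using (_∘_)
open import Relation.Nullary using (does; yes; no)
open import Relation.Nullary.Decidable using (T?)
open import Relation.Binary.Definitions using (DecidableEquality)
open import Relation.Binary.PropositionalEquality
  using (_≡_; refl; sym; trans; cong; cong₂; subst; module ≡-Reasoning)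

T-ext : {a b : Bool} → (T a → T b) → (T b → T a) → a ≡ b
T-ext {false} {false} _ _ = refl
T-ext {false} {true}  _ g = ⊥-elim (g _)
T-ext {true}  {false} f _ = ⊥-elim (f _)
T-ext {true}  {true}  _ _ = refl

module _ {A B : Set} where

  all-map : (p : B → Bool) (f : A → B) (xs : List A) →
            all p (map f xs) ≡ all (p ∘ f) xs
  all-map p f xs = cong and (sym (map-∘ xs))

  any-map : (p : B → Bool) (f : A → B) (xs : List A) →
            any p (map f xs) ≡ any (p ∘ f) xs
  any-map p f xs = cong or (sym (map-∘ xs))

module _ {A : Set} {p q : A → Bool} (p≗q : ∀ x → p x ≡ q x) where

  all-cong : (xs : List A) → all p xs ≡ all q xs
  all-cong xs = cong and (map-cong p≗q xs)

  filterᵇ-cong : (xs : List A) → filterᵇ p xs ≡ filterᵇ q xs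
  filterᵇ-cong = filter-≐ (T? ∘ p) (T? ∘ q)
    ((λ {x} → subst T (p≗q x)) , (λ {x} → subst T (sym (p≗q x))))

module _ {V : Set} (v : V → Bool) where

  eval-embed : (f : PForm V) → eval v (embed f) ≡ evalᵖ v f
  eval-embed (pvar x) = refl
  eval-embed ⊤ᵖ       = refl
  eval-embed ⊥ᵖ       = refl
  eval-embed (f ∧ᵖ g) = cong₂ _∧_ (eval-embed f) (eval-embed g)
  eval-embed (f ∨ᵖ g) = cong₂ _∨_ (eval-embed f) (eval-embed g)

  eval-⋀ᶠ-map : {A : Set} (F : A → Form V) (xs : List A) →
                eval v (⋀ᶠ (map F xs)) ≡ all (eval v ∘ F) xs
  eval-⋀ᶠ-map F []       = refl
  eval-⋀ᶠ-map F (x ∷ xs) = cong (eval v (F x) ∧_) (eval-⋀ᶠ-map F xs)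

  eval-⋁ᶠ-map : {A : Set} (F : A → Form V) (xs : List A) →
                eval v (⋁ᶠ (map F xs)) ≡ any (eval v ∘ F) xs
  eval-⋁ᶠ-map F []       = refl
  eval-⋁ᶠ-map F (x ∷ xs) = cong (eval v (F x) ∨_) (eval-⋁ᶠ-map F xs)

  eval-⋁ᶠ-mapMaybe : {A : Set} (g : A → Maybe V) (xs : List A) →
                     eval v (⋁ᶠ (map (maybe′ var ⊥ᶠ ∘ g) xs)) ≡ any v (mapMaybe g xs)
  eval-⋁ᶠ-mapMaybe g [] = refl
  eval-⋁ᶠ-mapMaybe g (x ∷ xs) with g x
  ... | just y  = cong (v y ∨_) (eval-⋁ᶠ-mapMaybe g xs)
  ... | nothing = eval-⋁ᶠ-mapMaybe g xs

  evalᵖ-dual-⋁ᵖ : (fs : List (PForm V)) →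
                  evalᵖ v (dual (⋁ᵖ fs)) ≡ all (evalᵖ v ∘ dual) fs
  evalᵖ-dual-⋁ᵖ []       = refl
  evalᵖ-dual-⋁ᵖ (f ∷ fs) = cong (evalᵖ v (dual f) ∧_) (evalᵖ-dual-⋁ᵖ fs)

  evalᵖ-dual-⋀ᵖ-vars : (xs : List V) → evalᵖ v (dual (⋀ᵖ (map pvar xs))) ≡ any v xs
  evalᵖ-dual-⋀ᵖ-vars []       = refl
  evalᵖ-dual-⋀ᵖ-vars (x ∷ xs) = cong (v x ∨_) (evalᵖ-dual-⋀ᵖ-vars xs)

module DualPos {V : Set} (_≟_ : DecidableEquality V) (vars : List V)
               (complete : ∀ x → x ∈ vars) where
  open Finite _≟_ vars

  ∈ᵇ⇒∈ : {x : V} (S : List V) → T (x ∈ᵇ S) → x ∈ S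
  ∈ᵇ⇒∈ {x} S t = Any.map (λ {y} → from-does {y}) (any⁻ _ S t)
    where
    from-does : {y : V} → T (does (x ≟ y)) → x ≡ y
    from-does {y} t with x ≟ y
    ... | yes x≡y = x≡y
    ... | no  _   = ⊥-elim t

  ∈⇒∈ᵇ : {x : V} (S : List V) → x ∈ S → T (x ∈ᵇ S)
  ∈⇒∈ᵇ {x} S x∈S = any⁺ _ (Any.map to-does x∈S)
    where
    to-does : {y : V} → x ≡ y → T (does (x ≟ y))
    to-does refl with x ≟ x
    ... | yes _  = _
    ... | no x≢x = x≢x refl

  positives-minterm : (S : List V) → positives (minterm S) ≡ filterᵇ (_∈ᵇ S) vars
  positives-minterm S = go vars
    where
    go : (ws : List V) →
         positives (map (λ x → if x ∈ᵇ S then posL x else negL x) ws) ≡ filterᵇ (_∈ᵇ S) ws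
    go []       = refl
    go (w ∷ ws) with w ∈ᵇ S
    ... | true  = cong (w ∷_) (go ws)
    ... | false = go ws

  any-restrict : (v : V → Bool) (S : List V) → any v (filterᵇ (_∈ᵇ S) vars) ≡ any v S
  any-restrict v S = T-ext restrict extend
    where
    restrict : T (any v (filterᵇ (_∈ᵇ S) vars)) → T (any v S)
    restrict t with find (any⁻ v (filterᵇ (_∈ᵇ S) vars) t)
    ... | x , x∈ , vx =
      any⁺ v (lose (∈ᵇ⇒∈ S (proj₂ (∈-filter⁻ (T? ∘ (_∈ᵇ S)) {xs = vars} x∈))) vx)
    extend : T (any v S) → T (any v (filterᵇ (_∈ᵇ S) vars))
    extend t with find (any⁻ v S t)
    ... | x , x∈S , vx =
      any⁺ v (lose (∈-filter⁺ (T? ∘ (_∈ᵇ S)) (complete x) (∈⇒∈ᵇ S x∈S)) vx)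

  models : Form V → List (List V)
  models f = filterᵇ (λ S → eval ⟦ S ⟧ f) (subsets vars)

  evalᵖ-dual-pos : (v : V → Bool) (f : Form V) →
                   evalᵖ v (dual (pos f)) ≡ all (any v) (models f)
  evalᵖ-dual-pos v f = begin
    evalᵖ v (dual (pos f))
      ≡⟨ evalᵖ-dual-⋁ᵖ v (map conj (DNF f)) ⟩
    all (evalᵖ v ∘ dual) (map conj (map minterm (models f)))
      ≡⟨ all-map _ conj (map minterm (models f)) ⟩
    all (evalᵖ v ∘ dual ∘ conj) (map minterm (models f))
      ≡⟨ all-map _ minterm (models f) ⟩
    all (λ S → evalᵖ v (dual (conj (minterm S)))) (models f)
      ≡⟨ all-cong minterm-disjunction (models f) ⟩
    all (any v) (models f) ∎
    where
    open ≡-Reasoning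
    conj : List Lit → PForm V
    conj t = ⋀ᵖ (map pvar (positives t))
    minterm-disjunction : (S : List V) → evalᵖ v (dual (conj (minterm S))) ≡ any v S
    minterm-disjunction S = begin
      evalᵖ v (dual (conj (minterm S)))  ≡⟨ evalᵖ-dual-⋀ᵖ-vars v (positives (minterm S)) ⟩
      any v (positives (minterm S))      ≡⟨ cong (any v) (positives-minterm S) ⟩
      any v (filterᵇ (_∈ᵇ S) vars)       ≡⟨ any-restrict v S ⟩
      any v S                            ∎

module Net (𝒮 : BoundedSystem) where
  open BoundedSystem 𝒮
  open Component
  open Finite (_≟S_ 𝒮) (allStates 𝒮) using (_∈ᵇ_; ⟦_⟧)

  allStates-complete : (s : State 𝒮) → s ∈ allStates 𝒮
  allStates-complete (k , s) =
    ∈-concatMap⁺ (λ k → map (k ,_) (allFin (nS (C k))))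
                 (lose (∈-allFin k) (∈-map⁺ (k ,_) (∈-allFin s)))

  markedTraps : List (List (State 𝒮))
  markedTraps = filterᵇ (λ W → isTrap 𝒮 W ∧ isMarked 𝒮 W) (subsets (allStates 𝒮))

  eval-ΘN : (v : State 𝒮 → Bool) → eval v (ΘN 𝒮) ≡ all (any v) markedTraps
  eval-ΘN v = trans (eval-⋀ᶠ-map v (λ W → ⋁ᶠ (map var W)) markedTraps)
                    (all-cong (eval-⋁ᶠ-map v var) markedTraps)

  ΘΓ-trap : (W : List (State 𝒮)) → eval ⟦ W ⟧ (ΘΓ 𝒮) ≡ isTrap 𝒮 W
  ΘΓ-trap W = begin
    eval ⟦ W ⟧ (ΘΓ 𝒮)
      ≡⟨ eval-⋀ᶠ-map ⟦ W ⟧ condition (minimalModels 𝒮) ⟩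
    all (eval ⟦ W ⟧ ∘ condition) (minimalModels 𝒮)
      ≡⟨ all-cong condition-trap (minimalModels 𝒮) ⟩
    all (trapCondition ∘ transition) (minimalModels 𝒮)
      ≡⟨ sym (all-map trapCondition transition (minimalModels 𝒮)) ⟩
    isTrap 𝒮 W ∎
    where
    open ≡-Reasoning
    condition : List (Port 𝒮) → Form (State 𝒮)
    condition β = ⋁ᶠ (map (preF 𝒮) β) ⇒ᶠ ⋁ᶠ (map (postF 𝒮) β)
    transition : List (Port 𝒮) → List (State 𝒮) × List (State 𝒮)
    transition β = (mapMaybe (pre 𝒮) β , mapMaybe (post 𝒮) β)
    trapCondition : List (State 𝒮) × List (State 𝒮) → Bool
    trapCondition t = not (any (_∈ᵇ W) (proj₁ t)) ∨ any (_∈ᵇ W) (proj₂ t)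
    condition-trap : (β : List (Port 𝒮)) →
                     eval ⟦ W ⟧ (condition β) ≡ trapCondition (transition β)
    condition-trap β = cong₂ (λ a b → not a ∨ b)
      (eval-⋁ᶠ-mapMaybe ⟦ W ⟧ (pre 𝒮) β) (eval-⋁ᶠ-mapMaybe ⟦ W ⟧ (post 𝒮) β)

  Init-marked : (W : List (State 𝒮)) → eval ⟦ W ⟧ (Init 𝒮) ≡ isMarked 𝒮 W
  Init-marked W = trans (eval-⋁ᶠ-map ⟦ W ⟧ (λ k → var (k , s₀ (C k))) (allFin n))
                        (sym (any-map (_∈ᵇ W) (λ k → (k , s₀ (C k))) (allFin n)))

  models-are-marked-traps : (W : List (State 𝒮)) →
                            eval ⟦ W ⟧ (ΘΓ 𝒮 ∧ᶠ Init 𝒮) ≡ (isTrap 𝒮 W ∧ isMarked 𝒮 W)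
  models-are-marked-traps W = cong₂ _∧_ (ΘΓ-trap W) (Init-marked W)

theorem1 : (𝒮 : BoundedSystem) → ΘN 𝒮 ≡ᶠ embed (dual (posΘΓInit 𝒮))
theorem1 𝒮 v = begin
  eval v (ΘN 𝒮)                           ≡⟨ eval-ΘN v ⟩
  all (any v) markedTraps                 ≡⟨ cong (all (any v)) traps-are-models ⟩
  all (any v) (models (ΘΓ 𝒮 ∧ᶠ Init 𝒮))   ≡⟨ sym (evalᵖ-dual-pos v (ΘΓ 𝒮 ∧ᶠ Init 𝒮)) ⟩
  evalᵖ v (dual (posΘΓInit 𝒮))            ≡⟨ sym (eval-embed v (dual (posΘΓInit 𝒮))) ⟩
  eval v (embed (dual (posΘΓInit 𝒮)))     ∎
  where
  open ≡-Reasoning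
  open Net 𝒮
  open DualPos (_≟S_ 𝒮) (allStates 𝒮) allStates-complete
  traps-are-models : markedTraps ≡ models (ΘΓ 𝒮 ∧ᶠ Init 𝒮)
  traps-are-models = filterᵇ-cong (sym ∘ models-are-marked-traps) (subsets (allStates 𝒮))
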